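{- Let $(R,\mathfrak{m})$ be a finite commutative local ring with identity $1\neq 0$ and maximal ideal $\mathfrak{m}\neq\{0\}$. (i) If $\mathfrak{m}^2=\{0\}$, then $\alpha(\Gamma(R))=1$. (ii) If $\mathfrak{m}^2\neq\{0\}$, then $2\leq \alpha(\Gamma(R))\leq |Z^*(R)|-|\mathrm{Ann}(Z(R))^*|$.
   Context: $Z(R)$ is the set of zero-divisors of $R$; for a subset $A\subseteq R$, $A^*=A\setminus\{0\}$; $\mathrm{Ann}(Z(R))=\{r\in R: rz=0 \text{ for all } z\in Z(R)\}$. $\Gamma(R)$ is the simple undirected graph with vertex set $Z^*(R)$, two distinct vertices $x,y$ adjacent iff $xy=0$. $\alpha(G)$ is the independence number of a graph $G$ (maximum size of a set of pairwise non-adjacent vertices). -}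

module Defs where

open import Level using (0ℓ)
open import Data.Nat using (ℕ; _≤_)
open import Data.Fin using (Fin)
open import Data.Fin.Properties using (any?; all?) renaming (_≟_ to _≟ᶠ_)
open import Data.Fin.Subset using (Subset; _∈_; ∣_∣)
open import Data.Vec using (tabulate)
open import Data.Product using (Σ; ∃; _×_; _,_)
open import Data.Sum using (_⊎_)
open import Relation.Nullary using (¬_; Dec; does; ¬?; _×-dec_; _→-dec_)
open import Relation.Unary using (Pred; _⊆_)
open import Relation.Binary.PropositionalEquality using (_≡_; _≢_)
open import Algebra.Structures using (IsCommutativeRing)

-- Every finite
-- commutative ring is isomorphic to one whose carrier is Fin n
-- (n = |R|), and all notions below are invariant under isomorphism.
record FiniteCommRing (n : ℕ) : Set where
  infixl 6 _+_
  infixl 7 _*_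
  field
    _+_ _*_ : Fin n → Fin n → Fin n
    -_      : Fin n → Fin n
    0# 1#   : Fin n
    isCommutativeRing : IsCommutativeRing _≡_ _+_ _*_ -_ 0# 1#

module _ {n : ℕ} (R : FiniteCommRing n) where
  open FiniteCommRing R

  record IsIdeal (I : Pred (Fin n) 0ℓ) : Set where
    field
      zero∈ : I 0#
      +-closed : ∀ {x y} → I x → I y → I (x + y)
      *-closed : ∀ r {x} → I x → I (r * x)

  record IsMaximalIdeal (I : Pred (Fin n) 0ℓ) : Set₁ where
    field
      isIdeal : IsIdeal I
      proper  : ¬ I 1#
      maximal : ∀ (J : Pred (Fin n) 0ℓ) → IsIdeal J → I ⊆ J →
                (J ⊆ I) ⊎ (∀ x → J x)

  record IsLocalWithMaximalIdeal (m : Pred (Fin n) 0ℓ) : Set₁ where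
    field
      isMaximal : IsMaximalIdeal m
      unique    : ∀ (J : Pred (Fin n) 0ℓ) → IsMaximalIdeal J →
                  (J ⊆ m) × (m ⊆ J)

  data IdealProd (I J : Pred (Fin n) 0ℓ) : Pred (Fin n) 0ℓ where
    prod : ∀ {x y} → I x → J y → IdealProd I J (x * y)
    zer  : IdealProd I J 0#
    add  : ∀ {x y} → IdealProd I J x → IdealProd I J y → IdealProd I J (x + y)
    mul  : ∀ r {x} → IdealProd I J x → IdealProd I J (r * x)

  -- Zero-divisors: Z(R) = { x | ∃ y ≠ 0, x y = 0 } (so 0 ∈ Z(R)).
  ZeroDivisor : Pred (Fin n) 0ℓ
  ZeroDivisor x = ∃ λ y → y ≢ 0# × x * y ≡ 0#

  zeroDivisor? : ∀ x → Dec (ZeroDivisor x)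
  zeroDivisor? x = any? (λ y → ¬? (y ≟ᶠ 0#) ×-dec (x * y ≟ᶠ 0#))

  ZeroDivisor* : Pred (Fin n) 0ℓ
  ZeroDivisor* x = ZeroDivisor x × x ≢ 0#

  AnnZ : Pred (Fin n) 0ℓ
  AnnZ r = ∀ z → ZeroDivisor z → r * z ≡ 0#

  AnnZ* : Pred (Fin n) 0ℓ
  AnnZ* r = AnnZ r × r ≢ 0#

  Z*-set : Subset n
  Z*-set = tabulate λ x → does (zeroDivisor? x ×-dec ¬? (x ≟ᶠ 0#))

  AnnZ*-set : Subset n
  AnnZ*-set = tabulate λ r →
    does (all? (λ z → zeroDivisor? z →-dec (r * z ≟ᶠ 0#)) ×-dec ¬? (r ≟ᶠ 0#))

  card-Z* : ℕ
  card-Z* = ∣ Z*-set ∣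

  card-AnnZ* : ℕ
  card-AnnZ* = ∣ AnnZ*-set ∣

  -- Independent sets of the zero-divisor graph Γ(R): sets of vertices
  -- (elements of Z*(R)) no two distinct of which are adjacent
  -- (x, y adjacent iff x ≠ y and x y = 0).
  IsIndependentΓ : Subset n → Set
  IsIndependentΓ S =
    (∀ x → x ∈ S → ZeroDivisor* x) ×
    (∀ x y → x ∈ S → y ∈ S → x ≢ y → x * y ≢ 0#)

  IndependenceNumberΓ : ℕ → Set
  IndependenceNumberΓ k =
    (∃ λ S → IsIndependentΓ S × ∣ S ∣ ≡ k) ×
    (∀ S → IsIndependentΓ S → ∣ S ∣ ≤ k)

-- Every non-unit of a finite ring is a
-- zero-divisor (multiplication by it is not injective), and every non-unit
-- lies in a maximal ideal, hence in m; so Z(R) = m and the vertices of Γ(R)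
-- are the nonzero elements of m. If m² = 0 any two vertices are adjacent,
-- so α(Γ(R)) = 1. If m² ≠ 0 there are a, b ∈ m with ab ≠ 0; if a = b, then
-- a and a + a² are distinct and not adjacent, because a(a + a²) = (1 + a)a²
-- with 1 + a a unit. So α(Γ(R)) ≥ 2; and an independent set of size ≥ 2
-- avoids Ann(Z(R)), since each of its elements fails to annihilate another
-- element of the set.
module Submission where

open import Defs
open import Level using (0ℓ)
import Data.Nat as Nat
open import Data.Nat using (ℕ; zero; suc; _≤_; _∸_; z≤n; s≤s; _≤?_)
open import Data.Nat.Properties
  using (≤-pred; ≤-trans; ≰⇒>; ≤∧≢⇒<; n≤0⇒n≡0; n<1+n; +-suc; <⇒≱; m+n≤o⇒m≤o∸n)
  renaming (_≟_ to _≟ⁿ_)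
open import Data.Fin using (Fin; punchOut)
open import Data.Fin.Properties using (all?; pigeonhole; punchOut-injective; <⇒≢; suc-injective)
  renaming (_≟_ to _≟ᶠ_)
open import Data.Fin.Subset
  using (Subset; _∈_; _∉_; ∣_∣; inside; outside; ⁅_⁆; _∪_; Nonempty)
  renaming (_⊆_ to _⊆ˢ_)
open import Data.Fin.Subset.Properties
  using (_∈?_; ∣p∣≤n; ∣p∣≤∣x∷p∣; drop-∷-⊆; p⊂q⇒∣p∣<∣q∣; anySubset?;
         x∈⁅y⁆⇒x≡y; ∣⁅x⁆∣≡1; p⊆p∪q; q⊆p∪q; x∈p∪q⁻)
open import Data.Vec using (_∷_; []; tabulate)
open import Data.Vec.Base using (here; there)
open import Data.Vec.Properties using (lookup∘tabulate; []=⇒lookup; lookup⇒[]=)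
open import Data.Product using (∃; ∃₂; _×_; _,_; proj₁)
open import Data.Sum using (_⊎_; inj₁; inj₂; [_,_])
open import Data.Empty using (⊥-elim)
open import Function using (_∘_; id)
open import Relation.Nullary using (¬_; Dec; yes; no; does; ¬?; _×-dec_; _→-dec_; contradiction)
open import Relation.Nullary.Decidable using (dec-true; decidable-stable)
open import Relation.Unary using (Pred; _⊆_)
import Relation.Unary as U
open import Relation.Binary.PropositionalEquality
  using (_≡_; _≢_; refl; sym; trans; cong; cong₂; subst; module ≡-Reasoning)
open import Algebra.Bundles using (CommutativeRing)
open import Algebra.Structures using (IsCommutativeRing)
import Algebra.Properties.Ring as RingProperties

bounded-maximum : ∀ {P : Pred ℕ 0ℓ} → U.Decidable P → ∀ d → (∀ {k} → P k → k ≤ d) →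
                  ∀ {k₀} → P k₀ → ∃ λ k → P k × (∀ {k′} → P k′ → k′ ≤ k)
bounded-maximum {P} P? zero bound P₀ with P? zero
... | yes P0 = zero , P0 , bound
... | no ¬P0 = contradiction (subst P (n≤0⇒n≡0 (bound P₀)) P₀) ¬P0
bounded-maximum {P} P? (suc d) bound P₀ with P? (suc d)
... | yes Pd = suc d , Pd , bound
... | no ¬Pd = bounded-maximum P? d below P₀
  where
    below : ∀ {k} → P k → k ≤ d
    below Pk = ≤-pred (≤∧≢⇒< (bound Pk) (λ k≡ → ¬Pd (subst P k≡ Pk)))

largest-subset : ∀ {n} {P : Pred (Subset n) 0ℓ} → U.Decidable P → ∀ {S₀} → P S₀ →
                 ∃ λ S → P S × (∀ {T} → P T → ∣ T ∣ ≤ ∣ S ∣)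
largest-subset {n} {P} P? P₀ with bounded-maximum OfSize? n bound (_ , P₀ , refl)
  where
    OfSize : Pred ℕ 0ℓ
    OfSize k = ∃ λ S → P S × ∣ S ∣ ≡ k
    OfSize? : U.Decidable OfSize
    OfSize? k = anySubset? (λ S → P? S ×-dec (∣ S ∣ ≟ⁿ k))
    bound : ∀ {k} → OfSize k → k ≤ n
    bound (S , _ , refl) = ∣p∣≤n S
... | _ , (S , PS , refl) , largest = S , PS , λ PT → largest (_ , PT , refl)

∣p∣+∣q∣≤∣r∣ : ∀ {n} (p q r : Subset n) → p ⊆ˢ r → q ⊆ˢ r → (∀ {x} → x ∈ p → x ∉ q) →
              ∣ p ∣ Nat.+ ∣ q ∣ ≤ ∣ r ∣
∣p∣+∣q∣≤∣r∣ [] [] [] _ _ _ = z≤n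
∣p∣+∣q∣≤∣r∣ (inside ∷ p) (inside ∷ q) (_ ∷ r) _ _ disj = contradiction here (disj here)
∣p∣+∣q∣≤∣r∣ (inside ∷ p) (_ ∷ q) (outside ∷ r) p⊆r _ _ = contradiction (p⊆r here) λ ()
∣p∣+∣q∣≤∣r∣ (outside ∷ p) (inside ∷ q) (outside ∷ r) _ q⊆r _ = contradiction (q⊆r here) λ ()
∣p∣+∣q∣≤∣r∣ (inside ∷ p) (outside ∷ q) (inside ∷ r) p⊆r q⊆r disj =
  s≤s (∣p∣+∣q∣≤∣r∣ p q r (drop-∷-⊆ p⊆r) (drop-∷-⊆ q⊆r) (λ x∈p → disj (there x∈p) ∘ there))
∣p∣+∣q∣≤∣r∣ (outside ∷ p) (inside ∷ q) (inside ∷ r) p⊆r q⊆r disj rewrite +-suc ∣ p ∣ ∣ q ∣ =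
  s≤s (∣p∣+∣q∣≤∣r∣ p q r (drop-∷-⊆ p⊆r) (drop-∷-⊆ q⊆r) (λ x∈p → disj (there x∈p) ∘ there))
∣p∣+∣q∣≤∣r∣ (outside ∷ p) (outside ∷ q) (s ∷ r) p⊆r q⊆r disj =
  ≤-trans (∣p∣+∣q∣≤∣r∣ p q r (drop-∷-⊆ p⊆r) (drop-∷-⊆ q⊆r) (λ x∈p → disj (there x∈p) ∘ there))
          (∣p∣≤∣x∷p∣ s r)

x≢y⇒2≤∣⁅x⁆∪⁅y⁆∣ : ∀ {n} {x y : Fin n} → x ≢ y → 2 ≤ ∣ ⁅ x ⁆ ∪ ⁅ y ⁆ ∣
x≢y⇒2≤∣⁅x⁆∪⁅y⁆∣ {x = x} {y} x≢y =
  subst (_≤ ∣ ⁅ x ⁆ ∪ ⁅ y ⁆ ∣) (cong₂ Nat._+_ (∣⁅x⁆∣≡1 x) (∣⁅x⁆∣≡1 y))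
    (∣p∣+∣q∣≤∣r∣ ⁅ x ⁆ ⁅ y ⁆ _ (p⊆p∪q ⁅ y ⁆) (q⊆p∪q ⁅ x ⁆ ⁅ y ⁆)
       (λ x∈ y∈ → x≢y (trans (sym (x∈⁅y⁆⇒x≡y x x∈)) (x∈⁅y⁆⇒x≡y y y∈))))

1≤∣p∣⇒nonempty : ∀ {n} (p : Subset n) → 1 ≤ ∣ p ∣ → Nonempty p
1≤∣p∣⇒nonempty (inside ∷ p) _ = _ , here
1≤∣p∣⇒nonempty (outside ∷ p) 1≤∣p∣ with x , x∈p ← 1≤∣p∣⇒nonempty p 1≤∣p∣ = _ , there x∈p

2≤∣p∣⇒distinct : ∀ {n} (p : Subset n) → 2 ≤ ∣ p ∣ → ∃₂ λ x y → x ∈ p × y ∈ p × x ≢ y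
2≤∣p∣⇒distinct (inside ∷ p) (s≤s 1≤∣p∣) with y , y∈p ← 1≤∣p∣⇒nonempty p 1≤∣p∣ =
  _ , _ , here , there y∈p , λ ()
2≤∣p∣⇒distinct (outside ∷ p) 2≤∣p∣ with x , y , x∈p , y∈p , x≢y ← 2≤∣p∣⇒distinct p 2≤∣p∣ =
  _ , _ , there x∈p , there y∈p , x≢y ∘ suc-injective

module _ {n} {P : Pred (Fin n) 0ℓ} (P? : U.Decidable P) where

  ∈-tabulate-does⁺ : ∀ {x} → P x → x ∈ tabulate (does ∘ P?)
  ∈-tabulate-does⁺ {x} Px = lookup⇒[]= x _ (trans (lookup∘tabulate _ x) (dec-true (P? x) Px))

  ∈-tabulate-does⁻ : ∀ {x} → x ∈ tabulate (does ∘ P?) → P x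
  ∈-tabulate-does⁻ {x} x∈ with P? x | trans (sym (lookup∘tabulate _ x)) ([]=⇒lookup x∈)
  ... | yes Px | _ = Px
  ... | no _   | ()

missing-value⇒collision : ∀ {n} (f : Fin n → Fin n) {c} → (∀ i → f i ≢ c) →
                          ∃₂ λ i j → i ≢ j × f i ≡ f j
missing-value⇒collision {suc n} f {c} f≢c
  with i , j , i<j , eq ← pigeonhole (n<1+n n) (λ i → punchOut {i = c} (f≢c i ∘ sym)) =
  i , j , <⇒≢ i<j , punchOut-injective (f≢c i ∘ sym) (f≢c j ∘ sym) eq

module FiniteRing {n} (R : FiniteCommRing n) where

  open FiniteCommRing R
  open IsCommutativeRing isCommutativeRing using
    (+-assoc; +-identityʳ; -‿inverseʳ; *-assoc; *-comm; *-identityˡ; distribʳ; zeroˡ; zeroʳ)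
  open ≡-Reasoning

  commutativeRing : CommutativeRing 0ℓ 0ℓ
  commutativeRing = record { isCommutativeRing = isCommutativeRing }

  open RingProperties (CommutativeRing.ring commutativeRing)
    using (x[y-z]≈xy-xz; x∙y⁻¹≈ε⇒x≈y; x≈y⇒x∙y⁻¹≈ε; -1*x≈-x)

  IsUnit : Fin n → Set
  IsUnit x = ∃ λ u → u * x ≡ 1#

  zeroDivisor⇒¬unit : ∀ {x} → ZeroDivisor R x → ¬ IsUnit x
  zeroDivisor⇒¬unit {x} (y , y≢0 , xy≡0) (u , ux≡1) = y≢0 (begin
    y             ≡⟨ sym (*-identityˡ y) ⟩
    1# * y        ≡⟨ cong (_* y) ux≡1 ⟨
    (u * x) * y   ≡⟨ *-assoc u x y ⟩
    u * (x * y)   ≡⟨ cong (u *_) xy≡0 ⟩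
    u * 0#        ≡⟨ zeroʳ u ⟩
    0#            ∎)

  -- Multiplication by a non-unit misses 1, so by finiteness it is not injective.
  ¬unit⇒zeroDivisor : ∀ {x} → ¬ IsUnit x → ZeroDivisor R x
  ¬unit⇒zeroDivisor {x} ¬unit
    with i , j , i≢j , xi≡xj ← missing-value⇒collision (x *_) (λ u xu≡1 → ¬unit (u , trans (*-comm u x) xu≡1)) =
    i + - j , i≢j ∘ x∙y⁻¹≈ε⇒x≈y i j , trans (x[y-z]≈xy-xz x i j) (x≈y⇒x∙y⁻¹≈ε xi≡xj)

  *≢0⇒≢0 : ∀ {x y} → x * y ≢ 0# → x ≢ 0# × y ≢ 0#
  *≢0⇒≢0 {x} {y} xy≢0 = (λ { refl → xy≢0 (zeroˡ y) }) , (λ { refl → xy≢0 (zeroʳ x) })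

  ⟨_⟩ : Fin n → Pred (Fin n) 0ℓ
  ⟨ x ⟩ y = ∃ λ r → y ≡ r * x

  ⟨⟩-isIdeal : ∀ x → IsIdeal R ⟨ x ⟩
  ⟨⟩-isIdeal x = record
    { zero∈    = 0# , sym (zeroˡ x)
    ; +-closed = λ { (r , refl) (s , refl) → r + s , sym (distribʳ x r s) }
    ; *-closed = λ { t (r , refl) → t * r , sym (*-assoc t r x) }
    }

  x∈⟨x⟩ : ∀ x → ⟨ x ⟩ x
  x∈⟨x⟩ x = 1# , sym (*-identityˡ x)

  zeroDivisor⇒1∉⟨⟩ : ∀ {x} → ZeroDivisor R x → ¬ ⟨ x ⟩ 1#
  zeroDivisor⇒1∉⟨⟩ x-zd (r , 1≡rx) = zeroDivisor⇒¬unit x-zd (r , sym 1≡rx)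

  1+x∉ideal : ∀ {I x} → IsIdeal R I → ¬ I 1# → I x → ¬ I (1# + x)
  1+x∉ideal {I} {x} I-ideal 1∉I x∈I 1+x∈I =
    1∉I (subst I 1+x-x≡1 (+-closed 1+x∈I (*-closed (- 1#) x∈I)))
    where
      open IsIdeal I-ideal
      1+x-x≡1 : (1# + x) + - 1# * x ≡ 1#
      1+x-x≡1 = begin
        (1# + x) + - 1# * x  ≡⟨ cong (1# + x +_) (-1*x≈-x x) ⟩
        (1# + x) + - x       ≡⟨ +-assoc 1# x (- x) ⟩
        1# + (x + - x)       ≡⟨ cong (1# +_) (-‿inverseʳ x) ⟩
        1# + 0#              ≡⟨ +-identityʳ 1# ⟩
        1#                   ∎

  IdealProd-≡0 : ∀ {I J} → (∀ {a b} → I a → J b → a * b ≡ 0#) →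
                 ∀ {x} → IdealProd R I J x → x ≡ 0#
  IdealProd-≡0 IJ≡0 (prod a∈I b∈J) = IJ≡0 a∈I b∈J
  IdealProd-≡0 IJ≡0 zer             = refl
  IdealProd-≡0 IJ≡0 (add p q)
    rewrite IdealProd-≡0 IJ≡0 p | IdealProd-≡0 IJ≡0 q = +-identityʳ 0#
  IdealProd-≡0 IJ≡0 (mul r p)
    rewrite IdealProd-≡0 IJ≡0 p = zeroʳ r

  ∈-Z*-set⁺ : ∀ {x} → ZeroDivisor* R x → x ∈ Z*-set R
  ∈-Z*-set⁺ = ∈-tabulate-does⁺ (λ x → zeroDivisor? R x ×-dec ¬? (x ≟ᶠ 0#))

  ∈-AnnZ*-set⁻ : ∀ {r} → r ∈ AnnZ*-set R → AnnZ* R r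
  ∈-AnnZ*-set⁻ = ∈-tabulate-does⁻
    (λ r → all? (λ z → zeroDivisor? R z →-dec (r * z ≟ᶠ 0#)) ×-dec ¬? (r ≟ᶠ 0#))

  ⁅⁆-independent : ∀ {x} → ZeroDivisor* R x → IsIndependentΓ R ⁅ x ⁆
  ⁅⁆-independent {x} x∈Z* = vertices , nonadjacent
    where
      vertices : ∀ y → y ∈ ⁅ x ⁆ → ZeroDivisor* R y
      vertices y y∈ rewrite x∈⁅y⁆⇒x≡y x y∈ = x∈Z*
      nonadjacent : ∀ y z → y ∈ ⁅ x ⁆ → z ∈ ⁅ x ⁆ → y ≢ z → y * z ≢ 0#
      nonadjacent y z y∈ z∈ y≢z = contradiction (trans (x∈⁅y⁆⇒x≡y x y∈) (sym (x∈⁅y⁆⇒x≡y x z∈))) y≢z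

  pair-independent : ∀ {x y} → ZeroDivisor* R x → ZeroDivisor* R y → x * y ≢ 0# →
                     IsIndependentΓ R (⁅ x ⁆ ∪ ⁅ y ⁆)
  pair-independent {x} {y} x∈Z* y∈Z* xy≢0 = vertices , nonadjacent
    where
      x-or-y : ∀ {z} → z ∈ ⁅ x ⁆ ∪ ⁅ y ⁆ → z ≡ x ⊎ z ≡ y
      x-or-y z∈ with x∈p∪q⁻ ⁅ x ⁆ ⁅ y ⁆ z∈
      ... | inj₁ z∈⁅x⁆ = inj₁ (x∈⁅y⁆⇒x≡y x z∈⁅x⁆)
      ... | inj₂ z∈⁅y⁆ = inj₂ (x∈⁅y⁆⇒x≡y y z∈⁅y⁆)
      vertices : ∀ z → z ∈ ⁅ x ⁆ ∪ ⁅ y ⁆ → ZeroDivisor* R z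
      vertices z z∈ with x-or-y z∈
      ... | inj₁ refl = x∈Z*
      ... | inj₂ refl = y∈Z*
      nonadjacent : ∀ z w → z ∈ ⁅ x ⁆ ∪ ⁅ y ⁆ → w ∈ ⁅ x ⁆ ∪ ⁅ y ⁆ → z ≢ w → z * w ≢ 0#
      nonadjacent z w z∈ w∈ z≢w with x-or-y z∈ | x-or-y w∈
      ... | inj₁ refl | inj₁ refl = contradiction refl z≢w
      ... | inj₂ refl | inj₂ refl = contradiction refl z≢w
      ... | inj₁ refl | inj₂ refl = xy≢0
      ... | inj₂ refl | inj₁ refl = xy≢0 ∘ trans (*-comm x y)

  Γ-complete⇒independent-≤1 : (∀ {x y} → ZeroDivisor* R x → ZeroDivisor* R y → x * y ≡ 0#) →
                               ∀ {S} → IsIndependentΓ R S → ∣ S ∣ ≤ 1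
  Γ-complete⇒independent-≤1 complete {S} (vertices , nonadjacent) with ∣ S ∣ ≤? 1
  ... | yes ∣S∣≤1 = ∣S∣≤1
  ... | no ∣S∣≰1 with x , y , x∈S , y∈S , x≢y ← 2≤∣p∣⇒distinct S (≰⇒> ∣S∣≰1) =
    contradiction (complete (vertices x x∈S) (vertices y y∈S)) (nonadjacent x y x∈S y∈S x≢y)

  -- Each element of S has a partner in S that it does not annihilate,
  -- so S misses Ann(Z(R)); and Ann(Z(R))* ⊆ Z*(R) because S contains a vertex.
  independent-≤-∣Z*∣∸∣AnnZ*∣ : ∀ {S} → IsIndependentΓ R S → 2 ≤ ∣ S ∣ →
                               ∣ S ∣ ≤ card-Z* R ∸ card-AnnZ* R
  independent-≤-∣Z*∣∸∣AnnZ*∣ {S} (vertices , nonadjacent) 2≤∣S∣ =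
    m+n≤o⇒m≤o∸n ∣ S ∣ (∣p∣+∣q∣≤∣r∣ S (AnnZ*-set R) (Z*-set R)
      (λ {x} x∈S → ∈-Z*-set⁺ (vertices x x∈S)) AnnZ*⊆Z* S-disjoint-AnnZ*)
    where
      distinct : ∃₂ λ x y → x ∈ S × y ∈ S × x ≢ y
      distinct = 2≤∣p∣⇒distinct S 2≤∣S∣
      AnnZ*⊆Z* : AnnZ*-set R ⊆ˢ Z*-set R
      AnnZ*⊆Z* r∈ with x , _ , x∈S , _ ← distinct | r-ann , r≢0 ← ∈-AnnZ*-set⁻ r∈ =
        let x-zd , x≢0 = vertices x x∈S in
        ∈-Z*-set⁺ ((x , x≢0 , r-ann x x-zd) , r≢0)
      S-disjoint-AnnZ* : ∀ {r} → r ∈ S → r ∉ AnnZ*-set R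
      S-disjoint-AnnZ* {r} r∈S r∈ with x , y , x∈S , y∈S , x≢y ← distinct | r-ann , _ ← ∈-AnnZ*-set⁻ r∈
                                | r ≟ᶠ x
      ... | yes refl = nonadjacent r y r∈S y∈S x≢y (r-ann y (proj₁ (vertices y y∈S)))
      ... | no r≢x   = nonadjacent r x r∈S x∈S r≢x (r-ann x (proj₁ (vertices x x∈S)))

module Classical {n} (R : FiniteCommRing n) (decide : (P : Set) → Dec P) where

  open FiniteCommRing R
  open IsCommutativeRing isCommutativeRing using (*-identityʳ)
  open FiniteRing R using (IdealProd-≡0)

  toSubset : Pred (Fin n) 0ℓ → Subset n
  toSubset P = tabulate (does ∘ decide ∘ P)

  toSubset-isIdeal : ∀ {I} → IsIdeal R I → IsIdeal R (_∈ toSubset I)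
  toSubset-isIdeal {I} I-ideal = record
    { zero∈    = ∈⁺ zero∈
    ; +-closed = λ x∈ y∈ → ∈⁺ (+-closed (∈⁻ x∈) (∈⁻ y∈))
    ; *-closed = λ r x∈ → ∈⁺ (*-closed r (∈⁻ x∈))
    }
    where
      open IsIdeal I-ideal
      ∈⁺ : ∀ {x} → I x → x ∈ toSubset I
      ∈⁺ = ∈-tabulate-does⁺ (decide ∘ I)
      ∈⁻ : ∀ {x} → x ∈ toSubset I → I x
      ∈⁻ = ∈-tabulate-does⁻ (decide ∘ I)

  -- A proper ideal above I of largest size is maximal.
  proper⊆maximal : ∀ {I} → IsIdeal R I → ¬ I 1# → ∃ λ M → IsMaximalIdeal R M × I ⊆ M
  proper⊆maximal {I} I-ideal 1∉I = maximalOf (largest-subset (decide ∘ ProperAbove) I-proper)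
    where
      ProperAbove : Pred (Subset n) 0ℓ
      ProperAbove S = IsIdeal R (_∈ S) × 1# ∉ S × I ⊆ (_∈ S)

      I-proper : ProperAbove (toSubset I)
      I-proper = toSubset-isIdeal I-ideal
               , 1∉I ∘ ∈-tabulate-does⁻ (decide ∘ I)
               , ∈-tabulate-does⁺ (decide ∘ I)

      maximalOf : (∃ λ S → ProperAbove S × (∀ {T} → ProperAbove T → ∣ T ∣ ≤ ∣ S ∣)) →
                  ∃ λ M → IsMaximalIdeal R M × I ⊆ M
      maximalOf (S , (S-ideal , 1∉S , I⊆S) , largest) =
        (_∈ S) , record { isIdeal = S-ideal ; proper = 1∉S ; maximal = maximal } , I⊆S
        where
          maximal : ∀ J → IsIdeal R J → (_∈ S) ⊆ J → J ⊆ (_∈ S) ⊎ (∀ x → J x)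
          maximal J J-ideal S⊆J with decide (J 1#)
          ... | yes 1∈J = inj₂ λ x → subst J (*-identityʳ x) (IsIdeal.*-closed J-ideal x 1∈J)
          ... | no 1∉J = inj₁ λ {x} x∈J → decidable-stable (x ∈? S) λ x∉S →
            <⇒≱ (p⊂q⇒∣p∣<∣q∣ (∈J⁺ ∘ S⊆J , x , ∈J⁺ x∈J , x∉S))
                (largest (toSubset-isIdeal J-ideal , 1∉J ∘ ∈-tabulate-does⁻ (decide ∘ J) , ∈J⁺ ∘ S⊆J ∘ I⊆S))
            where
              ∈J⁺ : ∀ {y} → J y → y ∈ toSubset J
              ∈J⁺ = ∈-tabulate-does⁺ (decide ∘ J)

  independenceNumber : ∀ {S₀} → IsIndependentΓ R S₀ →
                       ∃ λ k → IndependenceNumberΓ R k × ∣ S₀ ∣ ≤ k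
  independenceNumber S₀-independent
    with S , S-independent , largest ← largest-subset (decide ∘ IsIndependentΓ R) S₀-independent =
    ∣ S ∣ , ((S , S-independent , refl) , λ _ → largest) , largest S₀-independent

  IdealProd≢0⇒product≢0 : ∀ {I J} → (∃ λ x → IdealProd R I J x × x ≢ 0#) →
                           ∃₂ λ a b → I a × J b × a * b ≢ 0#
  IdealProd≢0⇒product≢0 {I} {J} (x , x∈IJ , x≢0) with decide (∃₂ λ a b → I a × J b × a * b ≢ 0#)
  ... | yes ab≢0 = ab≢0
  ... | no ¬ab≢0 = contradiction (IdealProd-≡0 IJ≡0 x∈IJ) x≢0
    where
      IJ≡0 : ∀ {a b} → I a → J b → a * b ≡ 0#
      IJ≡0 {a} {b} a∈I b∈J = decidable-stable (a * b ≟ᶠ 0#) λ ab≢0 → ¬ab≢0 (a , b , a∈I , b∈J , ab≢0)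

module LocalRing {n} (R : FiniteCommRing n) {m : Pred (Fin n) 0ℓ}
                 (local : IsLocalWithMaximalIdeal R m) where

  open FiniteCommRing R
  open IsCommutativeRing isCommutativeRing using (*-identityˡ; distribˡ; distribʳ)
  open IsLocalWithMaximalIdeal local
  open IsMaximalIdeal isMaximal
  open IsIdeal isIdeal
  open FiniteRing R
  open RingProperties (CommutativeRing.ring commutativeRing) using (+-identityʳ-unique)
  open ≡-Reasoning

  m∪-isIdeal : ∀ P → IsIdeal R (λ x → m x ⊎ P)
  m∪-isIdeal P = record
    { zero∈    = inj₁ zero∈
    ; +-closed = λ { (inj₁ x∈m) (inj₁ y∈m) → inj₁ (+-closed x∈m y∈m)
                   ; (inj₁ _) (inj₂ p) → inj₂ p
                   ; (inj₂ p) _ → inj₂ p }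
    ; *-closed = λ { r (inj₁ x∈m) → inj₁ (*-closed r x∈m) ; r (inj₂ p) → inj₂ p }
    }

  -- Maximality of m applies to every predicate: m ∪ {x ∣ P} is either m
  -- (so ¬ P) or everything (so P, as 1 ∉ m).
  decide : (P : Set) → Dec P
  decide P with maximal (λ x → m x ⊎ P) (m∪-isIdeal P) inj₁
  ... | inj₁ m∪P⊆m = no (proper ∘ m∪P⊆m ∘ inj₂)
  ... | inj₂ m∪P≡R = yes ([ ⊥-elim ∘ proper , id ] (m∪P≡R 1#))

  open Classical R decide public

  m⇒zeroDivisor : ∀ {x} → m x → ZeroDivisor R x
  m⇒zeroDivisor x∈m = ¬unit⇒zeroDivisor λ { (u , ux≡1) → proper (subst m ux≡1 (*-closed u x∈m)) }

  zeroDivisor⇒m : ∀ {x} → ZeroDivisor R x → m x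
  zeroDivisor⇒m {x} x-zd
    with M , M-maximal , ⟨x⟩⊆M ← proper⊆maximal (⟨⟩-isIdeal x) (zeroDivisor⇒1∉⟨⟩ x-zd) =
    proj₁ (unique M M-maximal) (⟨x⟩⊆M (x∈⟨x⟩ x))

  m-nonadjacent⇒vertices : ∀ {a c} → m a → m c → a * c ≢ 0# →
                           ZeroDivisor* R a × ZeroDivisor* R c
  m-nonadjacent⇒vertices a∈m c∈m ac≢0 =
    let a≢0 , c≢0 = *≢0⇒≢0 ac≢0 in (m⇒zeroDivisor a∈m , a≢0) , (m⇒zeroDivisor c∈m , c≢0)

  -- a(a + a²) = (1 + a)a², and 1 + a ∉ m = Z(R).
  nonzero-square⇒nonadjacent : ∀ {a} → m a → a * a ≢ 0# →
                                a ≢ a + a * a × a * (a + a * a) ≢ 0#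
  nonzero-square⇒nonadjacent {a} a∈m a²≢0 =
    (λ a≡a+a² → a²≢0 (+-identityʳ-unique a (a * a) (sym a≡a+a²))) ,
    (λ a[a+a²]≡0 → 1+x∉ideal isIdeal proper a∈m
       (zeroDivisor⇒m (a * a , a²≢0 , trans (sym a[a+a²]≡[1+a]a²) a[a+a²]≡0)))
    where
      a[a+a²]≡[1+a]a² : a * (a + a * a) ≡ (1# + a) * (a * a)
      a[a+a²]≡[1+a]a² = begin
        a * (a + a * a)              ≡⟨ distribˡ a a (a * a) ⟩
        a * a + a * (a * a)          ≡⟨ cong (_+ a * (a * a)) (*-identityˡ (a * a)) ⟨
        1# * (a * a) + a * (a * a)   ≡⟨ distribʳ (a * a) 1# a ⟨
        (1# + a) * (a * a)           ∎

  nonadjacent-pair : (∃ λ x → IdealProd R m m x × x ≢ 0#) →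
                     ∃₂ λ a c → a ≢ c × m a × m c × a * c ≢ 0#
  nonadjacent-pair m²≢0 with a , b , a∈m , b∈m , ab≢0 ← IdealProd≢0⇒product≢0 m²≢0 | a ≟ᶠ b
  ... | no a≢b   = a , b , a≢b , a∈m , b∈m , ab≢0
  ... | yes refl = let a≢c , ac≢0 = nonzero-square⇒nonadjacent a∈m ab≢0 in
                   a , a + a * a , a≢c , a∈m , +-closed a∈m (*-closed a a∈m) , ac≢0

theorem14 : ∀ {n : ℕ} (R : FiniteCommRing n) (m : Pred (Fin n) 0ℓ) →
    FiniteCommRing.1# R ≢ FiniteCommRing.0# R →
    IsLocalWithMaximalIdeal R m →
    (∃ λ x → m x × x ≢ FiniteCommRing.0# R) →
    ((∀ x → IdealProd R m m x → x ≡ FiniteCommRing.0# R) →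
    IndependenceNumberΓ R 1) ×
    ((∃ λ x → IdealProd R m m x × x ≢ FiniteCommRing.0# R) →
    ∃ λ k → IndependenceNumberΓ R k × 2 ≤ k ×
    k ≤ card-Z* R ∸ card-AnnZ* R)
theorem14 R m _ local (x₀ , x₀∈m , x₀≢0) = α≡1 , 2≤α≤∣Z*∣∸∣AnnZ*∣
  where
    open FiniteCommRing R using (0#)
    open FiniteRing R
    open LocalRing R local

    α≡1 : (∀ x → IdealProd R m m x → x ≡ 0#) → IndependenceNumberΓ R 1
    α≡1 m²≡0 = (⁅ x₀ ⁆ , ⁅⁆-independent (m⇒zeroDivisor x₀∈m , x₀≢0) , ∣⁅x⁆∣≡1 x₀)
             , λ _ → Γ-complete⇒independent-≤1 λ (x-zd , _) (y-zd , _) →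
                       m²≡0 _ (prod (zeroDivisor⇒m x-zd) (zeroDivisor⇒m y-zd))

    2≤α≤∣Z*∣∸∣AnnZ*∣ : (∃ λ x → IdealProd R m m x × x ≢ 0#) →
                       ∃ λ k → IndependenceNumberΓ R k × 2 ≤ k × k ≤ card-Z* R ∸ card-AnnZ* R
    2≤α≤∣Z*∣∸∣AnnZ*∣ m²≢0
      with a , c , a≢c , a∈m , c∈m , ac≢0 ← nonadjacent-pair m²≢0
      with a-vertex , c-vertex ← m-nonadjacent⇒vertices a∈m c∈m ac≢0
      with k , α≡k@((S , S-independent , refl) , _) , ∣S₀∣≤k ←
             independenceNumber (pair-independent a-vertex c-vertex ac≢0) =
      let 2≤k = ≤-trans (x≢y⇒2≤∣⁅x⁆∪⁅y⁆∣ a≢c) ∣S₀∣≤k in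
      k , α≡k , 2≤k , independent-≤-∣Z*∣∸∣AnnZ*∣ S-independent 2≤k
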